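{- Let $S$ be an infinite commutative domain satisfying: (1) for any finite $A\subseteq S$ there is $x\in S$, neither zero nor a unit, with $(x)+(a_i)=S$ for all $a_i\in A\setminus\{0\}$; (2) for any finite $A\subseteq S$ with $0\notin A$ and any $a\in S$ neither zero nor a unit, there is $g\in S$ such that each $1+a_ig$ ($a_i\in A$) is neither zero nor a unit, $(a)+(1+a_ig)=S$ for each $a_i\in A$, and $(1+a_ig)+(1+a_jg)=S$ for distinct $a_i,a_j\in A$. Consider a first-order structure on $S$ extending the ring structure, and extend its language by two unary predicate symbols $P_1,P_2$; for $A,B\subseteq S$ let $S_{A,B}$ be the expansion in which $P_1$ is interpreted as $A$ and $P_2$ as $B$. Then there exists a first-order sentence $\Psi$ in this extended language such that: (i) if $A\subseteq B$, then $S_{A,B}\models\Psi$; (ii) if $A$ is a finite subset of $S$ and $B$ is any subset of $S$, then $S_{A,B}\models\Psi$ if and only if $|A|\le|B|$; (iii) if $A$ is infinite and $B$ is finite, then $S_{A,B}\not\models\Psi$. -}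

module Defs where

open import Level using (Level; _⊔_)
open import Algebra.Bundles using (CommutativeRing)
open import Data.Nat using (ℕ; zero; suc)
open import Data.Fin using (Fin)
open import Data.Product using (Σ; ∃; _×_; _,_; proj₁)
open import Data.Sum using (_⊎_)
open import Data.Empty using (⊥)
open import Data.Unit.Polymorphic using (⊤)
open import Data.List using (List)
open import Data.List.Membership.Propositional using (_∈_)
open import Data.List.Relation.Unary.Any using (Any)
open import Data.List.Relation.Unary.All using (All)
open import Relation.Nullary using (¬_)
open import Relation.Unary using (Pred)
open import Function.Bundles using (_⇔_)

-- First-order syntax: language of rings (0,1,+,·,-) plus two unary
-- predicate symbols P₁, P₂.  Variables are de Bruijn indices (Fin n).

data Term (n : ℕ) : Set where
  var  : Fin n → Term n
  𝟘 𝟙  : Term n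
  _⊕_  : Term n → Term n → Term n
  _⊗_  : Term n → Term n → Term n
  ⊝_   : Term n → Term n

data Formula (n : ℕ) : Set where
  _≐_   : Term n → Term n → Formula n
  P₁ P₂ : Term n → Formula n
  ⊥ᶠ    : Formula n
  ¬ᶠ_   : Formula n → Formula n
  _∧ᶠ_ _∨ᶠ_ _⇒ᶠ_ : Formula n → Formula n → Formula n
  ∀ᶠ ∃ᶠ : Formula (suc n) → Formula n

Sentence : Set
Sentence = Formula zero

module _ {c ℓ : Level} (R : CommutativeRing c ℓ) where
  open CommutativeRing R renaming (Carrier to S)

  extend : ∀ {n} → S → (Fin n → S) → Fin (suc n) → S
  extend x ρ Fin.zero    = x
  extend x ρ (Fin.suc i) = ρ i

  ⟦_⟧ₜ : ∀ {n} → Term n → (Fin n → S) → S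
  ⟦ var i ⟧ₜ ρ = ρ i
  ⟦ 𝟘 ⟧ₜ ρ = 0#
  ⟦ 𝟙 ⟧ₜ ρ = 1#
  ⟦ s ⊕ t ⟧ₜ ρ = ⟦ s ⟧ₜ ρ + ⟦ t ⟧ₜ ρ
  ⟦ s ⊗ t ⟧ₜ ρ = ⟦ s ⟧ₜ ρ * ⟦ t ⟧ₜ ρ
  ⟦ ⊝ t ⟧ₜ ρ = - ⟦ t ⟧ₜ ρ

  -- Tarski satisfaction in the expansion S_{A,B} (P₁ ↦ A, P₂ ↦ B).
  -- (Classical meaning is ensured by assuming excluded middle in the theorem.)
  Sat : ∀ {p n} (A B : Pred S p) → Formula n → (Fin n → S) → Set (c ⊔ ℓ ⊔ p)
  Sat {p} A B (s ≐ t) ρ = Level.Lift (c ⊔ p) (⟦ s ⟧ₜ ρ ≈ ⟦ t ⟧ₜ ρ)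
  Sat {p} A B (P₁ t) ρ = Level.Lift (c ⊔ ℓ) (A (⟦ t ⟧ₜ ρ))
  Sat {p} A B (P₂ t) ρ = Level.Lift (c ⊔ ℓ) (B (⟦ t ⟧ₜ ρ))
  Sat {p} A B ⊥ᶠ ρ = Level.Lift (c ⊔ ℓ ⊔ p) ⊥
  Sat {p} A B (¬ᶠ φ) ρ = ¬ Sat A B φ ρ
  Sat {p} A B (φ ∧ᶠ ψ) ρ = Sat A B φ ρ × Sat A B ψ ρ
  Sat {p} A B (φ ∨ᶠ ψ) ρ = Sat A B φ ρ ⊎ Sat A B ψ ρ
  Sat {p} A B (φ ⇒ᶠ ψ) ρ = Sat A B φ ρ → Sat A B ψ ρ
  Sat {p} A B (∀ᶠ φ) ρ = ∀ x → Sat A B φ (extend x ρ)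
  Sat {p} A B (∃ᶠ φ) ρ = Σ S λ x → Sat A B φ (extend x ρ)

  _⊨[_,_] : ∀ {p} → Sentence → Pred S p → Pred S p → Set (c ⊔ ℓ ⊔ p)
  Ψ ⊨[ A , B ] = Sat A B Ψ (λ ())

  IsUnit : S → Set (c ⊔ ℓ)
  IsUnit x = Σ S λ y → x * y ≈ 1#

  Comaximal : S → S → Set (c ⊔ ℓ)
  Comaximal x y = Σ S λ r → Σ S λ s → r * x + s * y ≈ 1#

  IsDomain : Set (c ⊔ ℓ)
  IsDomain = ¬ (1# ≈ 0#) × (∀ x y → x * y ≈ 0# → x ≈ 0# ⊎ y ≈ 0#)

  RespectsEq : ∀ {p} → Pred S p → Set (c ⊔ ℓ ⊔ p)
  RespectsEq A = ∀ {x y} → x ≈ y → A x → A y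

  FiniteSubset : ∀ {p} → Pred S p → Set (c ⊔ ℓ ⊔ p)
  FiniteSubset A = Σ (List S) λ xs → ∀ x → A x ⇔ Any (x ≈_) xs

  InfiniteRing : Set (c ⊔ ℓ)
  InfiniteRing = ¬ FiniteSubset {ℓ} (λ _ → ⊤)

  _⊆ₛ_ : ∀ {p} → Pred S p → Pred S p → Set (c ⊔ p)
  A ⊆ₛ B = ∀ x → A x → B x

  _≤card_ : ∀ {p} → Pred S p → Pred S p → Set (c ⊔ ℓ ⊔ p)
  A ≤card B = Σ (Σ S A → Σ S B) λ f →
              ∀ u v → proj₁ (f u) ≈ proj₁ (f v) → proj₁ u ≈ proj₁ v

  Cond1 : Set (c ⊔ ℓ)
  Cond1 = ∀ (as : List S) → Σ S λ x → ¬ (x ≈ 0#) × ¬ IsUnit x ×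
            (∀ a → a ∈ as → ¬ (a ≈ 0#) → Comaximal x a)

  Cond2 : Set (c ⊔ ℓ)
  Cond2 = ∀ (as : List S) → All (λ a → ¬ (a ≈ 0#)) as →
          ∀ a → ¬ (a ≈ 0#) → ¬ IsUnit a →
          Σ S λ g →
            (∀ ai → ai ∈ as →
               ¬ (1# + ai * g ≈ 0#) × ¬ IsUnit (1# + ai * g) × Comaximal a (1# + ai * g)) ×
            (∀ ai aj → ai ∈ as → aj ∈ as → ¬ (ai ≈ aj) →
               Comaximal (1# + ai * g) (1# + aj * g))

-- Ψ says: either A ⊆ B, or there are g, h, e such that x ↦ "the y ∈ B with
-- e ≡ y mod 1 + (x + h)g" is a well-defined injection A → B.  An injection
-- into a finite B forces A to be finite, which gives (iii) and half of (ii).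
-- Conversely let A = {x₁, …, xₙ} be finite and f : A ↪ B.  Choose h with every
-- xᵢ + h ≠ 0 (using that S is infinite), let a be a nonzero non-unit times
-- ∏_{i<j} (f xᵢ − f xⱼ), and apply (2) to the nonzero xᵢ + h to get g for which
-- the moduli qᵢ = 1 + (xᵢ + h)g are pairwise comaximal non-units, each comaximal
-- with a.  The Chinese remainder theorem yields e with e ≡ f xᵢ mod qᵢ, and
-- e ≡ f xᵢ mod qⱼ with i ≠ j is impossible: qⱼ would divide f xᵢ − f xⱼ, a
-- divisor of a, so qⱼ would be a unit.

module Submission where

open import Defs
open import Level using (Level; _⊔_; Lift; lift; lower)
open import Algebra.Bundles using (CommutativeRing)
open import Axiom.ExcludedMiddle using (ExcludedMiddle)
open import Data.Empty using (⊥-elim)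
open import Data.Fin using (#_)
import Data.Fin as Fin
open import Data.List using (List; []; _∷_; map; _++_; foldr)
open import Data.List.Membership.Propositional using (_∈_; find)
open import Data.List.Membership.Propositional.Properties using (∈-map⁺; ∈-++⁺ˡ; ∈-++⁺ʳ)
open import Data.List.Relation.Unary.All using (All; []; _∷_)
import Data.List.Relation.Unary.All as All
import Data.List.Relation.Unary.All.Properties as AllP
open import Data.List.Relation.Unary.AllPairs using (AllPairs; []; _∷_)
import Data.List.Relation.Unary.AllPairs as AllPairs
open import Data.List.Relation.Unary.Any using (Any; here; there)
import Data.List.Relation.Unary.Any as Any
open import Data.Nat using (suc)
open import Data.Product using (Σ; _×_; _,_; proj₁; proj₂)
open import Data.Sum using (_⊎_; inj₁; inj₂)
import Data.Sum as Sum
open import Data.Unit.Polymorphic using (tt)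
open import Function.Bundles using (_⇔_; mk⇔; Equivalence)
open import Relation.Nullary using (¬_; yes; no)
open import Relation.Nullary.Decidable using (map′)
open import Relation.Unary using (Pred)
open import Relation.Binary.PropositionalEquality using (_≡_)
import Relation.Binary.PropositionalEquality as ≡

lower-em : ∀ {a b} → ExcludedMiddle (a ⊔ b) → ExcludedMiddle a
lower-em {b = b} em {P} = map′ lower lift (em {Lift b P})

allPairs-mapWith∈ : ∀ {a r s} {A : Set a} {R : A → A → Set r} {T : A → A → Set s} {xs : List A} →
                    (∀ {x y} → x ∈ xs → y ∈ xs → R x y → T x y) → AllPairs R xs → AllPairs T xs
allPairs-mapWith∈ f []           = []
allPairs-mapWith∈ f (Rx ∷ Rxs) =
  All.tabulate (λ y∈ → f (here ≡.refl) (there y∈) (All.lookup Rx y∈)) ∷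
  allPairs-mapWith∈ (λ x∈ y∈ → f (there x∈) (there y∈)) Rxs

module RingTheory {c ℓ} (R : CommutativeRing c ℓ) where
  open CommutativeRing R renaming (Carrier to S)
  open import Algebra.Properties.Ring ring using (x∙y⁻¹≈ε⇒x≈y; x≈z//y; [y-z]x≈yx-zx)
  open import Algebra.Properties.CommutativeSemigroup.Divisibility *-commutativeSemigroup
    using (_∣_; _,_; x∣xy; x∣ʳyx; x∣ʳy⇒x∣ʳzy; ∣ʳ-trans)
  open import Algebra.Solver.Ring.NaturalCoefficients.Default commutativeSemiring
    using (solve; _:+_; _:*_; _:=_)
  open import Relation.Binary.Reasoning.Setoid setoid

  product : List S → S
  product = foldr _*_ 1#

  ∈⇒∣product : ∀ {x xs} → x ∈ xs → x ∣ product xs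
  ∈⇒∣product {x} {.x ∷ xs} (here ≡.refl) = x∣xy x (product xs)
  ∈⇒∣product {x} {y ∷ xs}  (there x∈) = x∣ʳy⇒x∣ʳzy y (∈⇒∣product x∈)

  -- Congruence is stated without subtraction so that its algebra is a
  -- semiring computation.
  infix 4 _≡_mod_
  _≡_mod_ : S → S → S → Set (c ⊔ ℓ)
  a ≡ b mod q = Σ S λ k → Σ S λ k′ → a + k * q ≈ b + k′ * q

  ≡-mod-sym : ∀ {a b q} → a ≡ b mod q → b ≡ a mod q
  ≡-mod-sym (k , k′ , eq) = k′ , k , sym eq

  ≡-mod-trans : ∀ {a b d q} → a ≡ b mod q → b ≡ d mod q → a ≡ d mod q
  ≡-mod-trans {a} {b} {d} {q} (k₁ , k₂ , eq₁) (k₃ , k₄ , eq₂) = k₁ + k₃ , k₄ + k₂ , (begin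
    a + (k₁ + k₃) * q      ≈⟨ solve 4 (λ a k₁ k₃ q → a :+ (k₁ :+ k₃) :* q := (a :+ k₁ :* q) :+ k₃ :* q) refl a k₁ k₃ q ⟩
    a + k₁ * q + k₃ * q    ≈⟨ +-congʳ eq₁ ⟩
    b + k₂ * q + k₃ * q    ≈⟨ solve 4 (λ b k₂ k₃ q → (b :+ k₂ :* q) :+ k₃ :* q := (b :+ k₃ :* q) :+ k₂ :* q) refl b k₂ k₃ q ⟩
    b + k₃ * q + k₂ * q    ≈⟨ +-congʳ eq₂ ⟩
    d + k₄ * q + k₂ * q    ≈⟨ solve 4 (λ d k₄ k₂ q → (d :+ k₄ :* q) :+ k₂ :* q := d :+ (k₄ :+ k₂) :* q) refl d k₄ k₂ q ⟩
    d + (k₄ + k₂) * q      ∎)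

  ≡-mod-respˡ : ∀ {a a′ b q} → a ≈ a′ → a ≡ b mod q → a′ ≡ b mod q
  ≡-mod-respˡ a≈a′ (k , k′ , eq) = k , k′ , trans (+-congʳ (sym a≈a′)) eq

  ≡-mod-respʳ : ∀ {a b b′ q} → b ≈ b′ → a ≡ b mod q → a ≡ b′ mod q
  ≡-mod-respʳ b≈b′ (k , k′ , eq) = k , k′ , trans eq (+-congʳ b≈b′)

  ≡-mod-resp-modulus : ∀ {a b q q′} → q ≈ q′ → a ≡ b mod q → a ≡ b mod q′
  ≡-mod-resp-modulus q≈q′ (k , k′ , eq) =
    k , k′ , trans (+-congˡ (*-congˡ (sym q≈q′))) (trans eq (+-congˡ (*-congˡ q≈q′)))

  -- x + y = 1 and q ∣ y make x ≡ 1 and y ≡ 0 modulo q.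
  ≡-mod-split : ∀ {x y q z w} → x + y ≈ 1# → q ∣ y → z * x + w * y ≡ z mod q
  ≡-mod-split {x} {y} {q} {z} {w} x+y≈1 (m , mq≈y) = z * m , w * m , (begin
    z * x + w * y + z * m * q    ≈⟨ solve 6 (λ z x w y m q → z :* x :+ w :* y :+ z :* m :* q := z :* (x :+ m :* q) :+ w :* y)
                                          refl z x w y m q ⟩
    z * (x + m * q) + w * y      ≈⟨ +-cong (*-congˡ (+-congˡ mq≈y)) (*-congˡ (sym mq≈y)) ⟩
    z * (x + y) + w * (m * q)    ≈⟨ +-cong (*-congˡ x+y≈1) (sym (*-assoc w m q)) ⟩
    z * 1# + w * m * q           ≈⟨ +-congʳ (*-identityʳ z) ⟩
    z + w * m * q                ∎)

  ≡-mod⇒∣- : ∀ {a b q} → a ≡ b mod q → q ∣ a - b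
  ≡-mod⇒∣- {a} {b} {q} (k , k′ , eq) = k′ - k , (begin
    (k′ - k) * q                           ≈⟨ [y-z]x≈yx-zx q k′ k ⟩
    k′ * q - k * q                         ≈⟨ +-identityʳ _ ⟨
    k′ * q - k * q + 0#                    ≈⟨ +-congˡ (-‿inverseʳ b) ⟨
    k′ * q - k * q + (b - b)               ≈⟨ solve 4 (λ K nK b nb → K :+ nK :+ (b :+ nb) := b :+ K :+ nK :+ nb)
                                                    refl (k′ * q) (- (k * q)) b (- b) ⟩
    (b + k′ * q) - k * q - b               ≈⟨ +-congʳ (x≈z//y a (k * q) (b + k′ * q) eq) ⟨
    a - b                                  ∎)

  comaximal-sym : ∀ {x y} → Comaximal R x y → Comaximal R y x
  comaximal-sym (r , s , eq) = s , r , trans (+-comm _ _) eq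

  comaximal-1 : ∀ q → Comaximal R q 1#
  comaximal-1 q = 0# , 1# , trans (+-cong (zeroˡ q) (*-identityˡ 1#)) (+-identityˡ 1#)

  comaximal-* : ∀ {q a b} → Comaximal R q a → Comaximal R q b → Comaximal R q (a * b)
  comaximal-* {q} {a} {b} (r₁ , s₁ , eq₁) (r₂ , s₂ , eq₂) =
    r₁ * r₂ * q + r₁ * s₂ * b + s₁ * r₂ * a , s₁ * s₂ , (begin
      (r₁ * r₂ * q + r₁ * s₂ * b + s₁ * r₂ * a) * q + s₁ * s₂ * (a * b)
        ≈⟨ solve 7 (λ r₁ r₂ s₁ s₂ q a b →
             (r₁ :* r₂ :* q :+ r₁ :* s₂ :* b :+ s₁ :* r₂ :* a) :* q :+ s₁ :* s₂ :* (a :* b)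
             := (r₁ :* q :+ s₁ :* a) :* (r₂ :* q :+ s₂ :* b)) refl r₁ r₂ s₁ s₂ q a b ⟩
      (r₁ * q + s₁ * a) * (r₂ * q + s₂ * b)  ≈⟨ *-cong eq₁ eq₂ ⟩
      1# * 1#                                ≈⟨ *-identityˡ 1# ⟩
      1#                                     ∎)

  comaximal-product : ∀ {q xs} → All (Comaximal R q) xs → Comaximal R q (product xs)
  comaximal-product {q} []           = comaximal-1 q
  comaximal-product (q⊥x ∷ q⊥xs) = comaximal-* q⊥x (comaximal-product q⊥xs)

  comaximal-∣ : ∀ {q a d} → Comaximal R q a → d ∣ a → Comaximal R q d
  comaximal-∣ {q} {a} {d} (r , s , eq) (k , kd≈a) = r , s * k , (begin
    r * q + s * k * d    ≈⟨ +-congˡ (trans (*-assoc s k d) (*-congˡ kd≈a)) ⟩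
    r * q + s * a        ≈⟨ eq ⟩
    1#                   ∎)

  comaximal∧∣⇒unit : ∀ {q d} → Comaximal R q d → q ∣ d → IsUnit R q
  comaximal∧∣⇒unit {q} {d} (r , s , eq) (k , kq≈d) = r + s * k , (begin
    q * (r + s * k)      ≈⟨ solve 4 (λ q r s k → q :* (r :+ s :* k) := r :* q :+ s :* (k :* q)) refl q r s k ⟩
    r * q + s * (k * q)  ≈⟨ +-congˡ (*-congˡ kq≈d) ⟩
    r * q + s * d        ≈⟨ eq ⟩
    1#                   ∎)

  chinese-remainder : ∀ {i} {I : Set i} (Q Y : I → S) (us : List I) →
                      AllPairs (λ u v → Comaximal R (Q u) (Q v)) us →
                      Σ S λ e → All (λ u → e ≡ Y u mod Q u) us
  chinese-remainder Q Y []       []                     = 0# , []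
  chinese-remainder Q Y (u ∷ us) (Qu⊥Qus ∷ Qus-pairwise)
    with chinese-remainder Q Y us Qus-pairwise | comaximal-product (AllP.map⁺ Qu⊥Qus)
  ... | e′ , e′-solves | r , s , rQu+sP≈1 =
    e′ * (r * Q u) + Y u * (s * P) ,
    ≡-mod-respˡ (+-comm _ _) (≡-mod-split (trans (+-comm _ _) rQu+sP≈1) (x∣ʳyx (Q u) r)) ∷
    All.zipWith (λ (e′≡Yv , Qv∣P) → ≡-mod-trans (≡-mod-split rQu+sP≈1 (x∣ʳy⇒x∣ʳzy s Qv∣P)) e′≡Yv)
                (e′-solves , All.tabulate (λ v∈ → ∈⇒∣product (∈-map⁺ Q v∈)))
    where
    P : S
    P = product (map Q us)

  differences : ∀ {i} {I : Set i} → (I → S) → List I → List S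
  differences Y []       = []
  differences Y (u ∷ us) = map (λ v → Y u - Y v) us ++ differences Y us

  differences-≉0 : ∀ {i} {I : Set i} {Y : I → S} {us} →
                   AllPairs (λ u v → ¬ Y u ≈ Y v) us → All (λ d → ¬ d ≈ 0#) (differences Y us)
  differences-≉0 []                   = []
  differences-≉0 (Yu≉Yus ∷ Yus-distinct) =
    AllP.++⁺ (AllP.map⁺ (All.map (λ Yu≉Yv d≈0 → Yu≉Yv (x∙y⁻¹≈ε⇒x≈y _ _ d≈0)) Yu≉Yus))
             (differences-≉0 Yus-distinct)

  ∈⇒≡⊎∈differences : ∀ {i} {I : Set i} (Y : I → S) {u v us} → u ∈ us → v ∈ us →
                     u ≡ v ⊎ (Y u - Y v) ∈ differences Y us ⊎ (Y v - Y u) ∈ differences Y us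
  ∈⇒≡⊎∈differences Y (here ≡.refl) (here ≡.refl) = inj₁ ≡.refl
  ∈⇒≡⊎∈differences Y (here ≡.refl) (there v∈) = inj₂ (inj₁ (∈-++⁺ˡ (∈-map⁺ _ v∈)))
  ∈⇒≡⊎∈differences Y (there u∈) (here ≡.refl) = inj₂ (inj₂ (∈-++⁺ˡ (∈-map⁺ _ u∈)))
  ∈⇒≡⊎∈differences Y {us = w ∷ us} (there u∈) (there v∈) =
    Sum.map₂ (Sum.map (∈-++⁺ʳ _) (∈-++⁺ʳ _)) (∈⇒≡⊎∈differences Y u∈ v∈)

  -- The Chinese remainder solution e ≡ Y u mod Q u pins down u: a modulus
  -- comaximal with a cannot divide a difference dividing a.
  residue-separation : ∀ {i} {I : Set i} (Q Y : I → S) (us : List I) {a : S} →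
    product (differences Y us) ∣ a →
    All (λ u → ¬ IsUnit R (Q u) × Comaximal R a (Q u)) us →
    AllPairs (λ u v → Comaximal R (Q u) (Q v)) us →
    Σ S λ e → All (λ u → e ≡ Y u mod Q u) us ×
              (∀ {u v} → u ∈ us → v ∈ us → e ≡ Y u mod Q v → u ≡ v)
  residue-separation Q Y us differences∣a Q-good Q-pairwise with chinese-remainder Q Y us Q-pairwise
  ... | e , e-solves = e , e-solves , unique
    where
    Q∤difference : ∀ {v d} → v ∈ us → d ∈ differences Y us → ¬ Q v ∣ d
    Q∤difference v∈ d∈ Qv∣d with All.lookup Q-good v∈
    ... | Qv-nonunit , a⊥Qv =
      Qv-nonunit (comaximal∧∣⇒unit (comaximal-∣ (comaximal-sym a⊥Qv) (∣ʳ-trans (∈⇒∣product d∈) differences∣a)) Qv∣d)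

    unique : ∀ {u v} → u ∈ us → v ∈ us → e ≡ Y u mod Q v → u ≡ v
    unique u∈ v∈ e≡Yu with ∈⇒≡⊎∈differences Y u∈ v∈ | ≡-mod-trans (≡-mod-sym e≡Yu) (All.lookup e-solves v∈)
    ... | inj₁ u≡v        | _     = u≡v
    ... | inj₂ (inj₁ d∈) | Yu≡Yv = ⊥-elim (Q∤difference v∈ d∈ (≡-mod⇒∣- Yu≡Yv))
    ... | inj₂ (inj₂ d∈) | Yu≡Yv = ⊥-elim (Q∤difference v∈ d∈ (≡-mod⇒∣- (≡-mod-sym Yu≡Yv)))

  *-≉0 : IsDomain R → ∀ {x y} → ¬ x ≈ 0# → ¬ y ≈ 0# → ¬ x * y ≈ 0#
  *-≉0 (_ , no-zero-divisors) x≉0 y≉0 xy≈0 = Sum.[ x≉0 , y≉0 ] (no-zero-divisors _ _ xy≈0)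

  product-≉0 : IsDomain R → ∀ {xs} → All (λ x → ¬ x ≈ 0#) xs → ¬ product xs ≈ 0#
  product-≉0 (1≉0 , _) []              = 1≉0
  product-≉0 domain    (x≉0 ∷ xs≉0) = *-≉0 domain x≉0 (product-≉0 domain xs≉0)

  *-nonunitˡ : ∀ {x y} → ¬ IsUnit R x → ¬ IsUnit R (x * y)
  *-nonunitˡ {x} {y} x-nonunit (v , xyv≈1) = x-nonunit (y * v , trans (sym (*-assoc x y v)) xyv≈1)

  separating-residues : IsDomain R → Cond2 R → ∀ {t} → ¬ t ≈ 0# → ¬ IsUnit R t →
    ∀ {i} {I : Set i} (X Y : I → S) (us : List I) →
    All (λ u → ¬ X u ≈ 0#) us → AllPairs (λ u v → ¬ X u ≈ X v) us → AllPairs (λ u v → ¬ Y u ≈ Y v) us →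
    Σ S λ g → Σ S λ e → All (λ u → e ≡ Y u mod 1# + X u * g) us ×
                        (∀ {u v} → u ∈ us → v ∈ us → e ≡ Y u mod 1# + X v * g → u ≡ v)
  separating-residues domain cond2 {t} t≉0 t-nonunit X Y us X≉0 X-distinct Y-distinct
    with cond2 (map X us) (AllP.map⁺ X≉0) (t * product (differences Y us))
               (*-≉0 domain t≉0 (product-≉0 domain (differences-≉0 Y-distinct))) (*-nonunitˡ t-nonunit)
  ... | g , Q-good , Q-pairwise =
    g , residue-separation (λ u → 1# + X u * g) Y us (x∣ʳyx _ t)
          (All.tabulate (λ u∈ → proj₂ (Q-good _ (∈-map⁺ X u∈))))
          (allPairs-mapWith∈ (λ u∈ v∈ → Q-pairwise _ _ (∈-map⁺ X u∈) (∈-map⁺ X v∈)) X-distinct)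

module FiniteSubsets {c ℓ p} (R : CommutativeRing c ℓ) (em : ExcludedMiddle (c ⊔ ℓ ⊔ p)) where
  open CommutativeRing R renaming (Carrier to S)

  fresh-element : InfiniteRing R → (xs : List S) → Σ S λ h → All (λ x → ¬ h ≈ x) xs
  fresh-element infinite xs with lower-em {b = p} em {Σ S λ h → All (λ x → ¬ h ≈ x) xs}
  ... | yes fresh     = fresh
  ... | no none-fresh = ⊥-elim (infinite (xs , λ z → mk⇔ (λ _ → listed z) (λ _ → tt)))
    where
    listed : ∀ z → Any (z ≈_) xs
    listed z with lower-em {b = p} em {Any (z ≈_) xs}
    ... | yes z∈ = z∈
    ... | no z∉  = ⊥-elim (none-fresh (z , AllP.¬Any⇒All¬ xs z∉))

  module _ {A : Pred S p} where

    deduplicate : (xs : List S) → (∀ {x} → Any (x ≈_) xs → A x) →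
      Σ (List (Σ S A)) λ us → AllPairs (λ u v → ¬ proj₁ u ≈ proj₁ v) us ×
                               (∀ {x} → Any (x ≈_) xs → Any (λ u → x ≈ proj₁ u) us)
    deduplicate []       _  = [] , [] , λ ()
    deduplicate (x ∷ xs) inA with deduplicate xs (λ x∈ → inA (there x∈))
    ... | us , distinct , covers with em {Any (λ u → x ≈ proj₁ u) us}
    ...   | yes x∈us = us , distinct ,
      λ { (here y≈x) → Any.map (trans y≈x) x∈us ; (there y∈) → covers y∈ }
    ...   | no x∉us  = (x , inA (here refl)) ∷ us , AllP.¬Any⇒All¬ us x∉us ∷ distinct ,
      λ { (here y≈x) → here y≈x ; (there y∈) → there (covers y∈) }

    distinct-enumeration : FiniteSubset R A →
      Σ (List (Σ S A)) λ us → AllPairs (λ u v → ¬ proj₁ u ≈ proj₁ v) us ×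
                               (∀ x → A x → Any (λ u → x ≈ proj₁ u) us)
    distinct-enumeration (xs , A⇔∈xs) with deduplicate xs (λ {x} → Equivalence.from (A⇔∈xs x))
    ... | us , distinct , covers = us , distinct , λ x Ax → covers (Equivalence.to (A⇔∈xs x) Ax)

  preimages : ∀ {A B : Pred S p} (f : Σ S A → Σ S B) → (∀ u v → proj₁ (f u) ≈ proj₁ (f v) → proj₁ u ≈ proj₁ v) →
    (ys : List S) → Σ (List S) λ zs → All A zs × (∀ u → Any (proj₁ (f u) ≈_) ys → Any (proj₁ u ≈_) zs)
  preimages f f-injective [] = [] , [] , λ _ ()
  preimages {A} f f-injective (y ∷ ys) with preimages f f-injective ys | em {Σ (Σ S A) λ u → proj₁ (f u) ≈ y}
  ... | zs , A-zs , covers | yes (u₀ , fu₀≈y) = proj₁ u₀ ∷ zs , proj₂ u₀ ∷ A-zs ,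
    λ { u (here fu≈y) → here (f-injective u u₀ (trans fu≈y (sym fu₀≈y))) ; u (there fu∈) → there (covers u fu∈) }
  ... | zs , A-zs , covers | no no-preimage = zs , A-zs ,
    λ { u (here fu≈y) → ⊥-elim (no-preimage (u , fu≈y)) ; u (there fu∈) → covers u fu∈ }

  ≤card-finite : ∀ {A B : Pred S p} → RespectsEq R A → _≤card_ R A B → FiniteSubset R B → FiniteSubset R A
  ≤card-finite A-resp (f , f-injective) (ys , B⇔∈ys) =
    let (zs , A-zs , covers) = preimages f f-injective ys
    in zs , λ x → mk⇔ (λ Ax → covers (x , Ax) (Equivalence.to (B⇔∈ys _) (proj₂ (f (x , Ax)))))
                      (All.lookupₛ setoid A-resp A-zs)

wk : ∀ {n} → Term n → Term (suc n)
wk (var i) = var (Fin.suc i)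
wk 𝟘       = 𝟘
wk 𝟙       = 𝟙
wk (s ⊕ t) = wk s ⊕ wk t
wk (s ⊗ t) = wk s ⊗ wk t
wk (⊝ t)   = ⊝ wk t

_≡ᶠ_mod_ : ∀ {n} → Term n → Term n → Term n → Formula n
a ≡ᶠ b mod q = ∃ᶠ (∃ᶠ ((wk (wk a) ⊕ (var (# 1) ⊗ wk (wk q))) ≐ (wk (wk b) ⊕ (var (# 0) ⊗ wk (wk q)))))

modulusᵗ : ∀ {n} → Term n → Term n → Term n → Term n
modulusᵗ g h x = 𝟙 ⊕ ((x ⊕ h) ⊗ g)

-- The de Bruijn contexts inside codesᶠ are, innermost variable first,
-- (x, e, h, g), then (y, x, e, h, g), then (x′, y, x, e, h, g).
Ψ : Sentence
Ψ = ∀ᶠ (P₁ (var (# 0)) ⇒ᶠ P₂ (var (# 0))) ∨ᶠ ∃ᶠ (∃ᶠ (∃ᶠ codesᶠ))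
  where
  codesᶠ : Formula 3
  codesᶠ =
    ∀ᶠ (P₁ (var (# 0)) ⇒ᶠ
      ∃ᶠ (P₂ (var (# 0)) ∧ᶠ
        ((var (# 2) ≡ᶠ var (# 0) mod modulusᵗ (var (# 4)) (var (# 3)) (var (# 1))) ∧ᶠ
         ∀ᶠ (P₁ (var (# 0)) ⇒ᶠ
           ((var (# 3) ≡ᶠ var (# 1) mod modulusᵗ (var (# 5)) (var (# 4)) (var (# 0))) ⇒ᶠ
            (var (# 0) ≐ var (# 2)))))))

module Semantics {c ℓ p} (R : CommutativeRing c ℓ) (A B : Pred (CommutativeRing.Carrier R) p) where
  open CommutativeRing R renaming (Carrier to S)
  open import Algebra.Properties.Ring ring using (+-inverseʳ-unique; +-cancelʳ)
  open RingTheory R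

  modulus : S → S → S → S
  modulus g h x = 1# + (x + h) * g

  Codes : S → S → S → Set (c ⊔ ℓ ⊔ p)
  Codes g h e = ∀ x → A x → Σ S λ y → B y × e ≡ y mod modulus g h x ×
                                   (∀ x′ → A x′ → e ≡ y mod modulus g h x′ → x′ ≈ x)

  ⊨Ψ⇔ : _⊨[_,_] R Ψ A B ⇔ (_⊆ₛ_ R A B ⊎ Σ S λ g → Σ S λ h → Σ S λ e → Codes g h e)
  ⊨Ψ⇔ = mk⇔ to from
    where
    lower-≡ : ∀ {a b q} → (Σ S λ k → Σ S λ k′ → Lift (c ⊔ p) (a + k * q ≈ b + k′ * q)) → a ≡ b mod q
    lower-≡ (k , k′ , lift eq) = k , k′ , eq

    lift-≡ : ∀ {a b q} → a ≡ b mod q → Σ S λ k → Σ S λ k′ → Lift (c ⊔ p) (a + k * q ≈ b + k′ * q)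
    lift-≡ (k , k′ , eq) = k , k′ , lift eq

    to : _⊨[_,_] R Ψ A B → _⊆ₛ_ R A B ⊎ Σ S λ g → Σ S λ h → Σ S λ e → Codes g h e
    to (inj₁ A⊆B)                 = inj₁ λ x Ax → lower (A⊆B x (lift Ax))
    to (inj₂ (g , h , e , codes)) = inj₂ (g , h , e , λ x Ax →
      let (y , lift By , e≡y , unique) = codes x (lift Ax)
      in y , By , lower-≡ e≡y , λ x′ Ax′ e≡y′ → lower (unique x′ (lift Ax′) (lift-≡ e≡y′)))

    from : _⊆ₛ_ R A B ⊎ (Σ S λ g → Σ S λ h → Σ S λ e → Codes g h e) → _⊨[_,_] R Ψ A B
    from (inj₁ A⊆B)                 = inj₁ λ x Ax → lift (A⊆B x (lower Ax))
    from (inj₂ (g , h , e , codes)) = inj₂ (g , h , e , λ x Ax →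
      let (y , By , e≡y , unique) = codes x (lower Ax)
      in y , lift By , lift-≡ e≡y , λ x′ Ax′ e≡y′ → lift (unique x′ (lower Ax′) (lower-≡ e≡y′)))

  ⊆⇒≤card : _⊆ₛ_ R A B → _≤card_ R A B
  ⊆⇒≤card A⊆B = (λ (x , Ax) → x , A⊆B x Ax) , λ _ _ x≈x′ → x≈x′

  codes⇒≤card : ∀ {g h e} → Codes g h e → _≤card_ R A B
  codes⇒≤card codes = code , injective
    where
    code : Σ S A → Σ S B
    code (x , Ax) = let (y , By , _) = codes x Ax in y , By

    injective : ∀ u v → proj₁ (code u) ≈ proj₁ (code v) → proj₁ u ≈ proj₁ v
    injective (x , Ax) (x′ , Ax′) y≈y′ =
      let (_ , _ , _ , unique) = codes x Ax
          (_ , _ , e≡y′ , _)   = codes x′ Ax′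
      in sym (unique x′ Ax′ (≡-mod-respʳ (sym y≈y′) e≡y′))

  ⊨Ψ⇒≤card : _⊨[_,_] R Ψ A B → _≤card_ R A B
  ⊨Ψ⇒≤card ⊨Ψ = Sum.[ ⊆⇒≤card , (λ (_ , _ , _ , codes) → codes⇒≤card codes) ] (Equivalence.to ⊨Ψ⇔ ⊨Ψ)

  modulus-cong : ∀ {g h x y} → x ≈ y → modulus g h x ≈ modulus g h y
  modulus-cong x≈y = +-congˡ (*-congʳ (+-congʳ x≈y))

  separation⇒codes : ∀ {g h e} (f : Σ S A → Σ S B) (us : List (Σ S A)) →
    (∀ x → A x → Any (λ u → x ≈ proj₁ u) us) →
    All (λ u → e ≡ proj₁ (f u) mod modulus g h (proj₁ u)) us →
    (∀ {u v} → u ∈ us → v ∈ us → e ≡ proj₁ (f u) mod modulus g h (proj₁ v) → u ≡ v) →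
    Codes g h e
  separation⇒codes f us covers e-solves unique x Ax =
    let (u , u∈ , x≈u) = find (covers x Ax)
    in proj₁ (f u) , proj₂ (f u) , ≡-mod-resp-modulus (modulus-cong (sym x≈u)) (All.lookup e-solves u∈) ,
       λ x′ Ax′ e≡fu →
         let (u′ , u′∈ , x′≈u′) = find (covers x′ Ax′)
             u≡u′ = unique u∈ u′∈ (≡-mod-resp-modulus (modulus-cong x′≈u′) e≡fu)
         in trans x′≈u′ (trans (reflexive (≡.cong proj₁ (≡.sym u≡u′))) (sym x≈u))

  finite-injection⇒codes : ExcludedMiddle (c ⊔ ℓ ⊔ p) → IsDomain R → InfiniteRing R → Cond1 R → Cond2 R →
    FiniteSubset R A → _≤card_ R A B → Σ S λ g → Σ S λ h → Σ S λ e → Codes g h e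
  finite-injection⇒codes em domain infinite cond1 cond2 A-finite (f , f-injective) =
    let (us , distinct , covers) = FiniteSubsets.distinct-enumeration R em A-finite
        (h , h-fresh)            = FiniteSubsets.fresh-element {p = p} R em infinite (map (λ u → - proj₁ u) us)
        (t , t≉0 , t-nonunit , _) = cond1 []
        (g , e , e-solves , unique) =
          separating-residues domain cond2 t≉0 t-nonunit (λ u → proj₁ u + h) (λ u → proj₁ (f u)) us
            (All.map (λ h≉-u u+h≈0 → h≉-u (+-inverseʳ-unique _ _ u+h≈0)) (AllP.map⁻ h-fresh))
            (AllPairs.map (λ u≉v u+h≈v+h → u≉v (+-cancelʳ h _ _ u+h≈v+h)) distinct)
            (AllPairs.map (λ u≉v fu≈fv → u≉v (f-injective _ _ fu≈fv)) distinct)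
    in g , h , e , separation⇒codes f us covers e-solves unique

lemma2p6 : ∀ {c ℓ} (p : Level) (R : CommutativeRing c ℓ) →
    ExcludedMiddle (c ⊔ ℓ ⊔ p) →
    IsDomain R → InfiniteRing R → Cond1 R → Cond2 R →
    Σ Sentence λ Ψ →
      (∀ (A B : Pred (CommutativeRing.Carrier R) p) → RespectsEq R A → RespectsEq R B →
        _⊆ₛ_ R A B → _⊨[_,_] R Ψ A B) ×
      (∀ (A B : Pred (CommutativeRing.Carrier R) p) → RespectsEq R A → RespectsEq R B →
        FiniteSubset R A → (_⊨[_,_] R Ψ A B ⇔ _≤card_ R A B)) ×
      (∀ (A B : Pred (CommutativeRing.Carrier R) p) → RespectsEq R A → RespectsEq R B →
        ¬ FiniteSubset R A → FiniteSubset R B → ¬ _⊨[_,_] R Ψ A B)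
lemma2p6 p R em domain infinite cond1 cond2 =
  Ψ ,
  (λ A B _ _ A⊆B → Equivalence.from (⊨Ψ⇔ A B) (inj₁ A⊆B)) ,
  (λ A B _ _ A-finite → mk⇔ (⊨Ψ⇒≤card A B) λ A≤B →
     Equivalence.from (⊨Ψ⇔ A B) (inj₂ (finite-injection⇒codes A B em domain infinite cond1 cond2 A-finite A≤B))) ,
  (λ A B A-resp _ A-infinite B-finite ⊨Ψ →
     A-infinite (FiniteSubsets.≤card-finite R em A-resp (⊨Ψ⇒≤card A B ⊨Ψ) B-finite))
  where
  open Semantics R
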